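{- Let $S$ be a saw with backbone $(v_1,\dots,v_{2k+1},v_1)$ and degree $d(S)=d\geq k$, and let $x,y$ be two distinct vertices of $S$. Then there exists an integer $l>d$ such that \[ \left[\,l-\lceil d/2\rceil+5,\;l\,\right]\subset R_S(x,y). \]
   Context: A graph $S$ with vertex set $\{v_1,\dots,v_{2k+1}\}$ ($k\geq1$) is a saw if it contains the Hamiltonian cycle $(v_1,\dots,v_{2k+1},v_1)$ (its backbone) together with the chords $(v_{2s-1},v_{2s+1})$ for every $s\in\{1,\dots,k\}$; other edges may also be present. Its degree is $d(S)=\min\{d_S(v_{2k}),d_S(v_{2k+1})\}$, degrees taken in $S$. For distinct vertices $u,v$, $R_S(u,v)$ is the set of orders (numbers of vertices) of all paths in $S$ joining $u$ to $v$. $[m,n]=\{m,\dots,n\}$. -}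

module Defs where

open import Data.Nat using (ℕ; zero; suc; _+_; _*_; _∸_; _≤_; _<_; _⊔_; _⊓_)
open import Data.Bool using (Bool; true; false; if_then_else_)
open import Data.Fin using (Fin; toℕ; fromℕ)
import Data.Fin as F
open import Data.List using (List; []; _∷_; length; map; allFin; head; last)
open import Data.Nat.ListAction using (sum)
open import Data.List.Relation.Unary.Unique.Propositional using (Unique)
open import Data.Maybe using (Maybe; just; nothing)
open import Data.Product using (Σ; ∃; _×_; _,_)
open import Data.Unit using (⊤)
open import Relation.Binary.PropositionalEquality using (_≡_)

record Graph (n : ℕ) : Set where
  field
    adj     : Fin n → Fin n → Bool
    adj-sym : ∀ i j → adj i j ≡ adj j i
    adj-irr : ∀ i → adj i i ≡ false
open Graph public

Adj : ∀ {n} → Graph n → Fin n → Fin n → Set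
Adj G i j = adj G i j ≡ true

deg : ∀ {n} → Graph n → Fin n → ℕ
deg {n} G i = sum (map (λ j → if adj G i j then 1 else 0) (allFin n))

AdjChain : ∀ {n} → Graph n → List (Fin n) → Set
AdjChain G []            = ⊤
AdjChain G (a ∷ [])      = ⊤
AdjChain G (a ∷ b ∷ r)   = Adj G a b × AdjChain G (b ∷ r)

IsPath : ∀ {n} → Graph n → Fin n → Fin n → List (Fin n) → Set
IsPath G x y p = head p ≡ just x × last p ≡ just y × Unique p × AdjChain G p

-- m ∈ R_S(x,y): some x–y path has exactly m vertices (order m)
InR : ∀ {n} → Graph n → Fin n → Fin n → ℕ → Set
InR G x y m = Σ (List _) λ p → IsPath G x y p × length p ≡ m

-- Saw on vertex set Fin (2k+1), vertex v_i being the element with toℕ = i - 1.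
IsSaw : (k : ℕ) → Graph (suc (2 * k)) → Set
IsSaw k G =
  (∀ i j → toℕ j ≡ suc (toℕ i) → Adj G i j)
  × Adj G (fromℕ (2 * k)) F.zero
  -- chords (v_{2s-1} , v_{2s+1}), s ∈ [1,k]: toℕ i = 2(s-1), toℕ j = 2s
  × (∀ i j (t : ℕ) → toℕ i ≡ 2 * t → toℕ j ≡ 2 + toℕ i → Adj G i j)

-- v_{2k+1} and v_{2k} (for k ≥ 1, F.pred (fromℕ (2k)) has toℕ = 2k-1)
vLast vPrev : (k : ℕ) → Fin (suc (2 * k))
vLast k = fromℕ (2 * k)
vPrev k = F.pred (fromℕ (2 * k))

sawDeg : (k : ℕ) → Graph (suc (2 * k)) → ℕ
sawDeg k G = deg G (vPrev k) ⊓ deg G (vLast k)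

-- Label v_{i+1} by i, so that the backbone is 0 – 1 – ⋯ – b – 0 with b = 2k, the chords join 2t
-- and 2t + 2, and d is the smaller of the degrees of a = b − 1 and b.  A run along the backbone
-- over w + 1 consecutive vertices may skip odd vertices by chords, so it realises every order
-- between about w/2 and w + 1.  An x–y path assembled from at most three runs joined through b
-- therefore realises every order in [l − ⌈d/2⌉ + 5, l], where l is its full order.  The runs are
-- chosen so that the full path misses only the vertices of at most two gaps in which a (or b) has
-- no neighbour; counting the neighbours of that vertex gives d < l.
module Submission where

open import Defs
open import Data.Nat
  using (ℕ; zero; suc; _+_; _*_; _∸_; _≤_; _<_; z≤n; s≤s; s≤s⁻¹; z<s; s<s; _≤?_; ⌈_/2⌉)
open import Data.Nat.Properties
open import Data.Nat.ListAction using (sum)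
open import Data.Nat.Tactic.RingSolver using (solve-∀)
open import Algebra.Properties.CommutativeSemigroup +-commutativeSemigroup
  using () renaming (interchange to +-interchange)
open import Data.Bool using (true; false; if_then_else_)
import Data.Bool as Bool
open import Data.Fin as F using (Fin; toℕ; fromℕ)
open import Data.Fin.Properties
  using (toℕ-fromℕ<; toℕ-injective; toℕ-fromℕ; toℕ≤pred[n]; toℕ-inject₁)
open import Data.List as List
  using (List; []; _∷_; _++_; head; last; length; map; applyUpTo; tabulate; allFin)
open import Data.List.Properties
  using ( unfold-reverse; length-++; length-reverse; map-tabulate; tabulate-cong; length-map
        ; head-map; last-map; map-∘; map-id-local )
open import Data.List.Relation.Unary.All as All using (All; []; _∷_)
import Data.List.Relation.Unary.All.Properties as All
open import Data.List.Relation.Unary.AllPairs using ([]; _∷_)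
open import Data.List.Relation.Unary.Linked as Linked using (Linked; [-]; _∷_)
import Data.List.Relation.Unary.Linked.Properties as Linked
open import Data.List.Relation.Unary.Unique.Propositional using (Unique)
import Data.List.Relation.Unary.Unique.Propositional.Properties as Unique
open import Data.List.Relation.Binary.Permutation.Propositional using (↭-sym; ↭⇒↭ₛ)
open import Data.List.Relation.Binary.Permutation.Propositional.Properties
  using (↭-reverse; All-resp-↭)
import Data.List.Relation.Binary.Permutation.Setoid.Properties as PermutationSetoid
import Data.Maybe as Maybe
open import Data.Maybe using (just)
open import Data.Product using (Σ; ∃; ∃₂; _×_; _,_; proj₁; proj₂)
open import Data.Sum using (_⊎_; inj₁; inj₂)
open import Function using (_∘_; id)
open import Relation.Nullary using (¬_; Dec; yes; no; contradiction)
import Relation.Nullary.Decidable as Dec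
open import Relation.Unary using (Decidable)
open import Relation.Binary.Definitions using (tri<; tri≈; tri>)
open import Relation.Binary.PropositionalEquality

record Flexible (s : ℕ) (P : ℕ → Set) (u : ℕ) : Set where
  field
    lower   : ℕ
    lower≤u : lower ≤ u
    slack   : 2 * lower ≤ u + s
    holds   : ∀ m → lower ≤ m → m ≤ u → P m

open Flexible

flexible-single : ∀ {P} → P 1 → Flexible 1 P 1
flexible-single {P} p = record
  { lower = 1 ; lower≤u = ≤-refl ; slack = ≤-refl
  ; holds = λ m 1≤m m≤1 → subst P (≤-antisym 1≤m m≤1) p }

flexible-map : ∀ {s u} {P Q : ℕ → Set} → (∀ {m} → P m → Q m) → Flexible s P u → Flexible s Q u
flexible-map f F = record
  { lower = lower F ; lower≤u = lower≤u F ; slack = slack F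
  ; holds = λ m lo hi → f (holds F m lo hi) }

flexible-weaken : ∀ {s s′ u P} → s ≤ s′ → Flexible s P u → Flexible s′ P u
flexible-weaken {u = u} s≤s′ F = record
  { lower = lower F ; lower≤u = lower≤u F ; slack = ≤-trans (slack F) (+-monoʳ-≤ u s≤s′)
  ; holds = holds F }

split-between : ∀ {l₁ u₁ l₂ u₂ m} → l₁ ≤ u₁ → l₂ ≤ u₂ → l₁ + l₂ ≤ m → m ≤ u₁ + u₂ →
                ∃₂ λ m₁ m₂ → m₁ + m₂ ≡ m × (l₁ ≤ m₁ × m₁ ≤ u₁) × (l₂ ≤ m₂ × m₂ ≤ u₂)
split-between {l₁} {u₁} {l₂} {u₂} {m} l₁≤u₁ l₂≤u₂ lo hi with m ≤? l₁ + u₂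
... | yes m≤l₁+u₂ =
  l₁ , m ∸ l₁ , m+[n∸m]≡n (≤-trans (m≤m+n l₁ l₂) lo) ,
  (≤-refl , l₁≤u₁) ,
  (m+n≤o⇒m≤o∸n l₂ (subst (_≤ m) (+-comm l₁ l₂) lo) , m≤n+o⇒m∸n≤o m l₁ m≤l₁+u₂)
... | no m≰l₁+u₂ =
  m ∸ u₂ , u₂ , m∸n+n≡m (≤-trans (m≤n+m u₂ l₁) l₁+u₂≤m) ,
  (m+n≤o⇒m≤o∸n l₁ l₁+u₂≤m , subst (m ∸ u₂ ≤_) (m+n∸n≡m u₁ u₂) (∸-monoˡ-≤ u₂ hi)) ,
  (l₂≤u₂ , ≤-refl)
  where l₁+u₂≤m = <⇒≤ (≰⇒> m≰l₁+u₂)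

flexible-+ : ∀ {s₁ s₂ u₁ u₂} {P Q R : ℕ → Set} → (∀ {m n} → P m → Q n → R (m + n)) →
             Flexible s₁ P u₁ → Flexible s₂ Q u₂ → Flexible (s₁ + s₂) R (u₁ + u₂)
flexible-+ {s₁} {s₂} {u₁} {u₂} {R = R} f F₁ F₂ = record
  { lower = lower F₁ + lower F₂
  ; lower≤u = +-mono-≤ (lower≤u F₁) (lower≤u F₂)
  ; slack = ≤-trans (≤-reflexive (*-distribˡ-+ 2 (lower F₁) (lower F₂)))
              (≤-trans (+-mono-≤ (slack F₁) (slack F₂)) (≤-reflexive (+-interchange u₁ s₁ u₂ s₂)))
  ; holds = combine }
  where
  combine : ∀ m → lower F₁ + lower F₂ ≤ m → m ≤ u₁ + u₂ → R m
  combine m lo hi with split-between (lower≤u F₁) (lower≤u F₂) lo hi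
  ... | m₁ , m₂ , refl , (lo₁ , hi₁) , (lo₂ , hi₂) =
    f (holds F₁ m₁ lo₁ hi₁) (holds F₂ m₂ lo₂ hi₂)

Window : ℕ → (ℕ → Set) → Set
Window d P = Σ ℕ λ l → d < l × (∀ m → l + 5 ≤ m + ⌈ d /2⌉ → m ≤ l → P m)

⌈n/2⌉+⌈n/2⌉≤1+n : ∀ n → ⌈ n /2⌉ + ⌈ n /2⌉ ≤ suc n
⌈n/2⌉+⌈n/2⌉≤1+n n =
  ≤-trans (+-monoʳ-≤ ⌈ n /2⌉ (⌊n/2⌋≤⌈n/2⌉ (suc n))) (≤-reflexive (⌊n/2⌋+⌈n/2⌉≡n (suc n)))

window : ∀ {s P u} d → s ≤ 10 → d < u → Flexible s P u → Window d P
window {s} {u = u} d s≤10 d<u F = u , d<u , λ m near m≤u → holds F m (lower≤ m near) m≤u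
  where
  open ≤-Reasoning
  h = ⌈ d /2⌉
  lower≤ : ∀ m → u + 5 ≤ m + h → lower F ≤ m
  lower≤ m near = *-cancelˡ-≤ 2 (+-cancelʳ-≤ u _ _ (begin
    2 * lower F + u    ≤⟨ +-monoˡ-≤ u (≤-trans (slack F) (+-monoʳ-≤ u s≤10)) ⟩
    u + 10 + u         ≡⟨ double u ⟩
    (u + 5) + (u + 5)  ≤⟨ +-mono-≤ near near ⟩
    (m + h) + (m + h)  ≡⟨ reshape m h ⟩
    2 * m + (h + h)    ≤⟨ +-monoʳ-≤ (2 * m) (≤-trans (⌈n/2⌉+⌈n/2⌉≤1+n d) d<u) ⟩
    2 * m + u          ∎))
    where
    double : ∀ u → u + 10 + u ≡ (u + 5) + (u + 5)
    double = solve-∀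
    reshape : ∀ m h → (m + h) + (m + h) ≡ 2 * m + (h + h)
    reshape = solve-∀

window-map : ∀ {d} {P Q : ℕ → Set} → (∀ {m} → P m → Q m) → Window d P → Window d Q
window-map f (l , d<l , near) = l , d<l , λ m low m≤l → f (near m low m≤l)

unique-reverse : ∀ {A : Set} {xs : List A} → Unique xs → Unique (List.reverse xs)
unique-reverse {A} {xs} = PermutationSetoid.Unique-resp-↭ (setoid A) (↭⇒↭ₛ (↭-sym (↭-reverse xs)))

all-reverse : ∀ {A : Set} {P : A → Set} {xs : List A} → All P xs → All P (List.reverse xs)
all-reverse {xs = xs} = All-resp-↭ (↭-sym (↭-reverse xs))

module WalkIn {A : Set} (_~_ : A → A → Set) where

  infixr 5 _∷_
  data Walk : A → A → Set where
    [_] : ∀ v → Walk v v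
    _∷_ : ∀ {u v w} → u ~ v → Walk v w → Walk u w

  vertices : ∀ {u v} → Walk u v → List A
  vertices [ v ]       = v ∷ []
  vertices {u} (_ ∷ p) = u ∷ vertices p

  _▸⟨_⟩_ : ∀ {s t u v} → Walk s t → t ~ u → Walk u v → Walk s v
  [ _ ]   ▸⟨ e ⟩ q = e ∷ q
  (e′ ∷ p) ▸⟨ e ⟩ q = e′ ∷ (p ▸⟨ e ⟩ q)

  vertices-▸ : ∀ {s t u v} (p : Walk s t) (e : t ~ u) (q : Walk u v) →
               vertices (p ▸⟨ e ⟩ q) ≡ vertices p ++ vertices q
  vertices-▸ [ _ ]    e q = refl
  vertices-▸ (e′ ∷ p) e q = cong (_ ∷_) (vertices-▸ p e q)

  head-vertices : ∀ {u v} (p : Walk u v) → head (vertices p) ≡ just u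
  head-vertices [ _ ] = refl
  head-vertices (_ ∷ _) = refl

  last-vertices : ∀ {u v} (p : Walk u v) → last (vertices p) ≡ just v
  last-vertices [ _ ]           = refl
  last-vertices (_ ∷ [ _ ])     = refl
  last-vertices (_ ∷ p@(_ ∷ _)) = last-vertices p

  linked-vertices : ∀ {u v} (p : Walk u v) → Linked _~_ (vertices p)
  linked-vertices [ _ ]           = [-]
  linked-vertices (e ∷ [ _ ])     = e ∷ [-]
  linked-vertices (e ∷ p@(_ ∷ _)) = e ∷ linked-vertices p

  module Reversal (~-sym : ∀ {u v} → u ~ v → v ~ u) where

    reverse : ∀ {u v} → Walk u v → Walk v u
    reverse [ v ]       = [ v ]
    reverse {u} (e ∷ p) = reverse p ▸⟨ ~-sym e ⟩ [ u ]

    vertices-reverse : ∀ {u v} (p : Walk u v) → vertices (reverse p) ≡ List.reverse (vertices p)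
    vertices-reverse [ _ ]       = refl
    vertices-reverse {u} (e ∷ p) = begin
      vertices (reverse p ▸⟨ ~-sym e ⟩ [ u ]) ≡⟨ vertices-▸ (reverse p) (~-sym e) [ u ] ⟩
      vertices (reverse p) ++ u ∷ []          ≡⟨ cong (_++ u ∷ []) (vertices-reverse p) ⟩
      List.reverse (vertices p) ++ u ∷ []     ≡⟨ unfold-reverse u (vertices p) ⟨
      List.reverse (u ∷ vertices p)           ∎
      where open ≡-Reasoning

+-offset : ∀ s {m w n} → m + w ≡ n → s + m + w ≡ s + n
+-offset s {m} {w} e = trans (+-assoc s m w) (cong (s +_) e)

after-offset : ∀ s t t′ {g} → t + suc t′ ≡ g → suc (s + t) + t′ ≡ s + g
after-offset s t t′ e = trans (cong suc (+-assoc s t t′))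
  (trans (sym (+-suc s (t + t′))) (cong (s +_) (trans (sym (+-suc t t′)) e)))

module _ (P : ℕ → Set) where

  NoneIn : ℕ → ℕ → Set
  NoneIn s g = ∀ i → s ≤ i → i < s + g → ¬ P i

  record Span (s g : ℕ) : Set where
    field
      lowest highest after : ℕ
      lowest≤highest       : lowest ≤ highest
      highest+after        : highest + suc after ≡ g
      at-lowest            : P (s + lowest)
      at-highest           : P (s + highest)
      none-below           : NoneIn s lowest
      none-above           : NoneIn (suc (s + highest)) after

    end : suc (s + highest) + after ≡ s + g
    end = after-offset s highest after highest+after

module _ {P : ℕ → Set} where

  none-empty : ∀ s → NoneIn P s 0
  none-empty s i s≤i i<s+0 = contradiction s≤i (<⇒≱ (subst (i <_) (+-identityʳ s) i<s+0))

  none-sub : ∀ {s g s′ g′} → s ≤ s′ → s′ + g′ ≤ s + g → NoneIn P s g → NoneIn P s′ g′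
  none-sub s≤s′ end none i s′≤i i<end = none i (≤-trans s≤s′ s′≤i) (<-≤-trans i<end end)

  none-before-hit : ∀ {s r t} → NoneIn P s r → P (s + t) → r ≤ t
  none-before-hit {s} {r} {t} none hit with r ≤? t
  ... | yes r≤t = r≤t
  ... | no r≰t  = contradiction hit (none (s + t) (m≤m+n s t) (+-monoʳ-< s (≰⇒> r≰t)))

  none-extendˡ : ∀ {s g} → ¬ P s → NoneIn P (suc s) g → NoneIn P s (suc g)
  none-extendˡ {s} {g} ¬Ps none i s≤i i<s+1+g with m≤n⇒m<n∨m≡n s≤i
  ... | inj₂ refl = ¬Ps
  ... | inj₁ s<i  = none i s<i (subst (i <_) (+-suc s g) i<s+1+g)

  none-extendʳ : ∀ {s g} → NoneIn P s g → ¬ P (s + g) → NoneIn P s (suc g)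
  none-extendʳ {s} {g} none ¬Pend i s≤i i<end
    with m≤n⇒m<n∨m≡n (s≤s⁻¹ (subst (i <_) (+-suc s g) i<end))
  ... | inj₂ refl = ¬Pend
  ... | inj₁ i<s+g = none i s≤i i<s+g

  module _ (P? : Decidable P) where

    first-in : ∀ s g → NoneIn P s g ⊎ ∃₂ λ r r′ → r + suc r′ ≡ g × P (s + r) × NoneIn P s r
    first-in s zero = inj₁ (none-empty s)
    first-in s (suc g) with P? s
    ... | yes Ps = inj₂ (0 , g , refl , subst P (sym (+-identityʳ s)) Ps , none-empty s)
    ... | no ¬Ps with first-in (suc s) g
    ...   | inj₁ none = inj₁ (none-extendˡ ¬Ps none)
    ...   | inj₂ (r , r′ , e , hit , none) =
            inj₂ (suc r , r′ , cong suc e , subst P (sym (+-suc s r)) hit , none-extendˡ ¬Ps none)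

    last-in : ∀ s g →
              NoneIn P s g ⊎ ∃₂ λ t t′ → t + suc t′ ≡ g × P (s + t) × NoneIn P (suc (s + t)) t′
    last-in s zero = inj₁ (none-empty s)
    last-in s (suc g) with P? (s + g)
    ... | yes hit = inj₂ (g , 0 , +-comm g 1 , hit , none-empty _)
    ... | no miss with last-in s g
    ...   | inj₁ none = inj₁ (none-extendʳ none miss)
    ...   | inj₂ (t , t′ , e , hit , none) =
            inj₂ (t , suc t′ , trans (+-suc t (suc t′)) (cong suc e) , hit ,
                  none-extendʳ none (subst (λ j → ¬ P j) (sym (after-offset s t t′ e)) miss))

    span-in : ∀ s g → NoneIn P s g ⊎ Span P s g
    span-in s g with first-in s g
    ... | inj₁ none = inj₁ none
    ... | inj₂ (r , r′ , r+r′ , at-r , below) with last-in s g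
    ...   | inj₁ none = contradiction at-r (none (s + r) (m≤m+n s r)
                          (+-monoʳ-< s (subst (r <_) r+r′ (m<m+n r z<s))))
    ...   | inj₂ (t , t′ , t+t′ , at-t , above) =
            inj₂ (record { lowest = r ; highest = t ; after = t′
                         ; lowest≤highest = none-before-hit below at-t ; highest+after = t+t′
                         ; at-lowest = at-r ; at-highest = at-t ; none-below = below ; none-above = above })

tabulate-toℕ : ∀ {A : Set} n (f : ℕ → A) → tabulate {n = n} (λ j → f (toℕ j)) ≡ applyUpTo f n
tabulate-toℕ zero    f = refl
tabulate-toℕ (suc n) f = cong (f 0 ∷_) (tabulate-toℕ n (λ i → f (suc i)))

sum-applyUpTo-+ : ∀ n (f g : ℕ → ℕ) →
                  sum (applyUpTo (λ i → f i + g i) n) ≡ sum (applyUpTo f n) + sum (applyUpTo g n)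
sum-applyUpTo-+ zero    f g = refl
sum-applyUpTo-+ (suc n) f g = trans (cong (f 0 + g 0 +_) (sum-applyUpTo-+ n (f ∘ suc) (g ∘ suc)))
                                    (+-interchange (f 0) (g 0) _ _)

sum-applyUpTo-≤ : ∀ n (f : ℕ → ℕ) → (∀ i → f i ≤ 1) → sum (applyUpTo f n) ≤ n
sum-applyUpTo-≤ zero    f f≤1 = z≤n
sum-applyUpTo-≤ (suc n) f f≤1 =
  +-mono-≤ (f≤1 0) (sum-applyUpTo-≤ n (λ i → f (suc i)) (λ i → f≤1 (suc i)))

indicator : ℕ → ℕ → ℕ → ℕ
indicator (suc s) g       zero    = 0
indicator (suc s) g       (suc i) = indicator s g i
indicator zero    zero    i       = 0
indicator zero    (suc g) zero    = 1
indicator zero    (suc g) (suc i) = indicator zero g i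

sum-indicator : ∀ n s g → s + g ≤ n → sum (applyUpTo (indicator s g) n) ≡ g
sum-indicator zero    zero    zero    _         = refl
sum-indicator (suc n) (suc s) g       (s≤s le)  = sum-indicator n s g le
sum-indicator (suc n) zero    zero    _         = sum-indicator n zero zero z≤n
sum-indicator (suc n) zero    (suc g) (s≤s le)  = cong suc (sum-indicator n zero g le)

indicator-view : ∀ s g i → indicator s g i ≡ 0 ⊎ (indicator s g i ≡ 1 × s ≤ i × i < s + g)
indicator-view (suc s) g zero = inj₁ refl
indicator-view (suc s) g (suc i) with indicator-view s g i
... | inj₁ out              = inj₁ out
... | inj₂ (one , s≤i , i<) = inj₂ (one , s≤s s≤i , s<s i<)
indicator-view zero zero    i       = inj₁ refl
indicator-view zero (suc g) zero    = inj₂ (refl , z≤n , z<s)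
indicator-view zero (suc g) (suc i) with indicator-view zero g i
... | inj₁ out            = inj₁ out
... | inj₂ (one , _ , i<) = inj₂ (one , z≤n , s<s i<)

indicator-below : ∀ {s g i} → i < s → indicator s g i ≡ 0
indicator-below {s} {g} {i} i<s with indicator-view s g i
... | inj₁ is-zero      = is-zero
... | inj₂ (_ , s≤i , _) = contradiction s≤i (<⇒≱ i<s)

m≤n<m+1⇒n≡m : ∀ {m n} → m ≤ n → n < m + 1 → n ≡ m
m≤n<m+1⇒n≡m {m} {n} m≤n n<m+1 = ≤-antisym (s≤s⁻¹ (subst (n <_) (+-comm m 1) n<m+1)) m≤n

linked⇒adjChain : ∀ {n} {G : Graph n} {xs} → Linked (Adj G) xs → AdjChain G xs
linked⇒adjChain Linked.[] = _
linked⇒adjChain [-]       = _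
linked⇒adjChain (e ∷ l)   = e , linked⇒adjChain l

Even : ℕ → Set
Even n = ∃ λ t → n ≡ 2 * t

even-2+ : ∀ {n} → Even n → Even (2 + n)
even-2+ (t , refl) = suc t , sym (*-suc 2 t)

parity : ∀ n → Even n ⊎ Even (suc n)
parity zero = inj₁ (0 , refl)
parity (suc n) with parity n
... | inj₁ ev = inj₂ (even-2+ ev)
... | inj₂ ev = inj₁ ev

module Saw (k a : ℕ) (2k≡1+a : 2 * k ≡ suc a) (G : Graph (suc (2 * k))) (saw : IsSaw k G) where

  b : ℕ
  b = suc a

  -- Truncation at 2k only makes vertex total; it is never applied beyond b.
  vertex : ℕ → Fin (suc (2 * k))
  vertex i = F.fromℕ< (s≤s (m⊓n≤n i (2 * k)))

  toℕ-vertex : ∀ {i} → i ≤ b → toℕ (vertex i) ≡ i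
  toℕ-vertex {i} i≤b = trans (toℕ-fromℕ< _) (m≤n⇒m⊓n≡m (subst (i ≤_) (sym 2k≡1+a) i≤b))

  vertex-toℕ : ∀ j → vertex (toℕ j) ≡ j
  vertex-toℕ j = toℕ-injective (toℕ-vertex (subst (toℕ j ≤_) 2k≡1+a (toℕ≤pred[n] j)))

  -- A record rather than a synonym of Adj, so that its indices can be inferred.
  record _~_ (i j : ℕ) : Set where
    constructor edge
    field adjacent : Adj G (vertex i) (vertex j)
  open _~_

  _~?_ : ∀ i j → Dec (i ~ j)
  i ~? j = Dec.map′ edge adjacent (adj G (vertex i) (vertex j) Bool.≟ true)

  ~-sym : ∀ {i j} → i ~ j → j ~ i
  ~-sym {i} {j} (edge e) = edge (trans (adj-sym G (vertex j) (vertex i)) e)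

  ~-irrefl : ∀ i → ¬ (i ~ i)
  ~-irrefl i (edge e) with trans (sym e) (adj-irr G (vertex i))
  ... | ()

  step : ∀ {i} → i < b → i ~ suc i
  step i<b = edge (proj₁ saw _ _ (trans (toℕ-vertex i<b) (cong suc (sym (toℕ-vertex (<⇒≤ i<b))))))

  chord : ∀ {i} → Even i → 2 + i ≤ b → i ~ (2 + i)
  chord {i} (t , i≡2t) le = edge (proj₂ (proj₂ saw) _ _ t (trans (toℕ-vertex i≤b) i≡2t)
    (trans (toℕ-vertex le) (cong (2 +_) (sym (toℕ-vertex i≤b)))))
    where i≤b = ≤-trans (m≤n+m i 2) le

  close : b ~ 0
  close = edge (subst₂ (Adj G) last≡b first≡0 (proj₁ (proj₂ saw)))
    where
    last≡b = toℕ-injective (trans (toℕ-fromℕ (2 * k)) (trans 2k≡1+a (sym (toℕ-vertex ≤-refl))))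
    first≡0 = toℕ-injective (sym (toℕ-vertex z≤n))

  a<b : a < b
  a<b = ≤-refl

  a≤b : a ≤ b
  a≤b = n≤1+n a

  open WalkIn _~_
  open Reversal ~-sym

  InRange : ℕ → ℕ → ℕ → Set
  InRange lo hi v = lo ≤ v × v ≤ hi

  record Path (lo hi s t n : ℕ) : Set where
    field
      walk   : Walk s t
      unique : Unique (vertices walk)
      inside : All (InRange lo hi) (vertices walk)
      order  : length (vertices walk) ≡ n
  open Path

  Rising : ℕ → ℕ → ℕ → Set
  Rising lo hi = Path lo hi lo hi

  single : ∀ v → Path v v v v 1
  single v = record { walk = [ v ] ; unique = [] ∷ [] ; inside = (≤-refl , ≤-refl) ∷ [] ; order = refl }

  reversePath : ∀ {lo hi s t n} → Path lo hi s t n → Path lo hi t s n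
  reversePath p = record
    { walk   = reverse (walk p)
    ; unique = subst Unique (sym same) (unique-reverse (unique p))
    ; inside = subst (All _) (sym same) (all-reverse (inside p))
    ; order  = trans (cong length same) (trans (length-reverse (vertices (walk p))) (order p)) }
    where same = vertices-reverse (walk p)

  source-inside : ∀ {lo hi s t n} → Path lo hi s t n → InRange lo hi s
  source-inside record { walk = [ _ ] ; inside = r ∷ _ } = r
  source-inside record { walk = _ ∷ _ ; inside = r ∷ _ } = r

  range-nonempty : ∀ {lo hi s t n} → Path lo hi s t n → lo ≤ hi
  range-nonempty p = let (lo≤s , s≤hi) = source-inside p in ≤-trans lo≤s s≤hi

  join : ∀ {l₁ h₁ l₂ h₂ lo hi s t u v m n} →
         (∀ {i} → InRange l₁ h₁ i → ¬ InRange l₂ h₂ i) →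
         (∀ {i} → InRange l₁ h₁ i → InRange lo hi i) →
         (∀ {i} → InRange l₂ h₂ i → InRange lo hi i) →
         Path l₁ h₁ s t m → t ~ u → Path l₂ h₂ u v n → Path lo hi s v (m + n)
  join apart into₁ into₂ p e q = record
    { walk   = walk p ▸⟨ e ⟩ walk q
    ; unique = subst Unique (sym glued) (Unique.++⁺ (unique p) (unique q)
                 λ (i∈p , i∈q) → apart (All.lookup (inside p) i∈p) (All.lookup (inside q) i∈q))
    ; inside = subst (All _) (sym glued) (All.++⁺ (All.map into₁ (inside p)) (All.map into₂ (inside q)))
    ; order  = trans (cong length glued)
                     (trans (length-++ (vertices (walk p))) (cong₂ _+_ (order p) (order q))) }
    where glued = vertices-▸ (walk p) e (walk q)

  join↑ : ∀ {l₁ h₁ l₂ h₂ s t u v m n} → h₁ < l₂ →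
          Path l₁ h₁ s t m → t ~ u → Path l₂ h₂ u v n → Path l₁ h₂ s v (m + n)
  join↑ h₁<l₂ p e q = join
    (λ (_ , i≤h₁) (l₂≤i , _) → <⇒≱ (<-≤-trans h₁<l₂ l₂≤i) i≤h₁)
    (λ (l₁≤i , i≤h₁) → l₁≤i , ≤-trans i≤h₁ (≤-trans (<⇒≤ h₁<l₂) (range-nonempty q)))
    (λ (l₂≤i , i≤h₂) → ≤-trans (range-nonempty p) (≤-trans (<⇒≤ h₁<l₂) l₂≤i) , i≤h₂)
    p e q

  join↓ : ∀ {l₁ h₁ l₂ h₂ s t u v m n} → h₂ < l₁ →
          Path l₁ h₁ s t m → t ~ u → Path l₂ h₂ u v n → Path l₂ h₁ s v (m + n)
  join↓ h₂<l₁ p e q = join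
    (λ (l₁≤i , _) (_ , i≤h₂) → <⇒≱ (<-≤-trans h₂<l₁ l₁≤i) i≤h₂)
    (λ (l₁≤i , i≤h₁) → ≤-trans (range-nonempty q) (≤-trans (<⇒≤ h₂<l₁) l₁≤i) , i≤h₁)
    (λ (l₂≤i , i≤h₂) → l₂≤i , ≤-trans i≤h₂ (≤-trans (<⇒≤ h₂<l₁) (range-nonempty p)))
    p e q

  widen : ∀ {lo hi lo′ hi′ s t n} → lo′ ≤ lo → hi ≤ hi′ → Path lo hi s t n → Path lo′ hi′ s t n
  widen lo′≤lo hi≤hi′ p = record
    { walk = walk p ; unique = unique p ; order = order p
    ; inside = All.map (λ (lo≤i , i≤hi) → ≤-trans lo′≤lo lo≤i , ≤-trans i≤hi hi≤hi′)
                       (inside p) }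

  segment : ∀ lo w → lo + w ≤ b → Rising lo (lo + w) (suc w)
  segment lo zero    _  = subst (λ hi → Rising lo hi 1) (sym (+-identityʳ lo)) (single lo)
  segment lo (suc w) le = subst (λ hi → Rising lo hi (suc (suc w))) (sym (+-suc lo w))
    (join↑ ≤-refl (single lo) (step (<-≤-trans (m<m+n lo z<s) le))
                  (segment (suc lo) w (subst (_≤ b) (+-suc lo w) le)))

  even-run-of-order : ∀ {lo} w m → Even lo → lo + w ≤ b → ⌈ w /2⌉ < m → m ≤ suc w →
                      Rising lo (lo + w) m
  even-run-of-order {lo} w m ev le m-big m-small with m ≟ suc w
  ... | yes refl = segment lo w le
  even-run-of-order zero       m ev le m-big m-small | no m≢1 = contradiction (≤-antisym m-small m-big) m≢1
  even-run-of-order (suc zero) m ev le m-big m-small | no m≢2 = contradiction (≤-antisym m-small m-big) m≢2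
  even-run-of-order {lo} (suc (suc w)) (suc m) ev le m-big m-small | no m≢ =
    subst (λ hi → Rising lo hi (suc m)) shift
      (join↑ (n≤1+n (suc lo)) (single lo) (chord ev (≤-trans (m≤m+n (2 + lo) w) le′))
             (even-run-of-order w m (even-2+ ev) le′ (s≤s⁻¹ m-big)
                                (s≤s⁻¹ (s≤s⁻¹ (≤∧≢⇒< m-small m≢)))))
    where
    shift : 2 + lo + w ≡ lo + suc (suc w)
    shift = sym (trans (+-suc lo (suc w)) (cong suc (+-suc lo w)))
    le′ = subst (_≤ b) (sym shift) le

  even-run : ∀ {lo} w → Even lo → lo + w ≤ b → Flexible 2 (Rising lo (lo + w)) (suc w)
  even-run w ev le = record
    { lower = suc ⌈ w /2⌉ ; lower≤u = s≤s (⌈n/2⌉≤n w) ; slack = half-plus-one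
    ; holds = λ m big small → even-run-of-order w m ev le big small }
    where
    open ≤-Reasoning
    h = ⌈ w /2⌉
    half-plus-one : 2 * suc h ≤ suc w + 2
    half-plus-one = begin
      2 * suc h    ≡⟨ *-suc 2 h ⟩
      2 + 2 * h    ≡⟨ cong (2 +_) (cong (h +_) (+-identityʳ h)) ⟩
      2 + (h + h)  ≤⟨ +-monoʳ-≤ 2 (⌈n/2⌉+⌈n/2⌉≤1+n w) ⟩
      2 + suc w    ≡⟨ +-comm 2 (suc w) ⟩
      suc w + 2    ∎

  run : ∀ {lo hi} w → lo + w ≡ hi → hi ≤ b → Flexible 3 (Rising lo hi) (suc w)
  run {lo} w refl le with parity lo
  ... | inj₁ ev = flexible-weaken (n≤1+n 2) (even-run w ev le)
  run {lo} zero refl le | inj₂ _ =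
    flexible-weaken (s≤s z≤n)
      (flexible-single (subst (λ hi → Rising lo hi 1) (sym (+-identityʳ lo)) (single lo)))
  run {lo} (suc w) refl le | inj₂ ev =
    flexible-map (λ {m} → subst (λ hi → Rising lo hi m) (sym (+-suc lo w)))
      (flexible-+ (λ p q → join↑ ≤-refl p (step (<-≤-trans (m<m+n lo z<s) le)) q)
                  (flexible-single (single lo)) (even-run w ev (subst (_≤ b) (+-suc lo w) le)))

  descent : ∀ {lo hi} w → lo + w ≡ hi → hi ≤ b → Flexible 3 (Path lo hi hi lo) (suc w)
  descent w e le = flexible-map reversePath (run w e le)

  -- x ↓ 0, b, a ↓ y
  round-b : ∀ {x y w} → x < y → y + w ≡ a → Flexible 7 (Path 0 b x y) (suc x + (1 + suc w))
  round-b {x} {y} {w} x<y y+w≡a =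
    flexible-+ (λ P Q → join↑ x<y P (~-sym close) Q)
               (descent {0} x refl (<⇒≤ (<-≤-trans x<y y≤b))) via-b
    where
    y≤b = ≤-trans (m≤m+n y w) (m≤n⇒m≤1+n (≤-reflexive y+w≡a))
    via-b : Flexible 4 (Path y b b y) (1 + suc w)
    via-b = flexible-+ (λ P Q → join↓ a<b P (~-sym (step a<b)) Q) (flexible-single (single b))
              (descent w y+w≡a a≤b)

  -- x ↓ 0, b, p ⋯ q, a ↓ y
  round-b-middle : ∀ {x lo w p q y w₄} → x < lo → lo + w < y → y + w₄ ≡ a → b ~ p → q ~ a →
                   Flexible 3 (Path lo (lo + w) p q) (suc w) →
                   Flexible 10 (Path 0 b x y) (suc x + (1 + (suc w + suc w₄)))
  round-b-middle {x} {lo} {w} {p} {q} {y} {w₄} x<lo hi<y y+w₄≡a b~p q~a middle =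
    flexible-+ (λ P Q → join↑ x<lo P (~-sym close) Q) (descent {0} x refl x≤b) via-b
    where
    y≤a = ≤-trans (m≤m+n y w₄) (≤-reflexive y+w₄≡a)
    x≤b = ≤-trans (<⇒≤ (<-≤-trans x<lo (≤-trans (m≤m+n lo w) (<⇒≤ hi<y)))) (m≤n⇒m≤1+n y≤a)
    onward : Flexible 6 (Path lo a p y) (suc w + suc w₄)
    onward = flexible-+ (λ P Q → join↑ hi<y P q~a Q) middle (descent w₄ y+w₄≡a a≤b)
    via-b : Flexible 7 (Path lo b b y) (1 + (suc w + suc w₄))
    via-b = flexible-+ (λ P Q → join↓ a<b P b~p Q) (flexible-single (single b)) onward

  -- x ↑ a, b
  up-to-b : ∀ {x w} → x + w ≡ a → Flexible 4 (Path 0 b x b) (suc w + 1)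
  up-to-b {w = w} x+w≡a = flexible-+ (λ P Q → widen z≤n ≤-refl (join↑ a<b P (step a<b) Q))
                            (run w x+w≡a a≤b) (flexible-single (single b))

  -- x ↑ a, r ↓ 0, b
  up-back-to-b : ∀ {x w r} → x + w ≡ a → r < x → a ~ r →
                 Flexible 7 (Path 0 b x b) ((suc w + suc r) + 1)
  up-back-to-b {x} {w} {r} x+w≡a r<x a~r =
    flexible-+ (λ P Q → join↑ a<b P (~-sym close) Q) up-and-back (flexible-single (single b))
    where
    r≤b = ≤-trans (<⇒≤ r<x) (≤-trans (m≤m+n x w) (m≤n⇒m≤1+n (≤-reflexive x+w≡a)))
    up-and-back : Flexible 6 (Path 0 a x 0) (suc w + suc r)
    up-and-back = flexible-+ (λ P Q → join↓ r<x P a~r Q) (run w x+w≡a a≤b) (descent {0} r refl r≤b)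

  Avoids : ℕ → ℕ → ℕ → Set
  Avoids v = NoneIn (v ~_)

  nbr : ℕ → ℕ → ℕ
  nbr v i = if adj G (vertex v) (vertex i) then 1 else 0

  nbr-≤1 : ∀ v i → nbr v i ≤ 1
  nbr-≤1 v i with adj G (vertex v) (vertex i)
  ... | true  = ≤-refl
  ... | false = z≤n

  nbr-zero : ∀ {v i} → ¬ (v ~ i) → nbr v i ≡ 0
  nbr-zero {v} {i} ¬v~i with adj G (vertex v) (vertex i) in e
  ... | true  = contradiction (edge e) ¬v~i
  ... | false = refl

  degree-as-sum : ∀ v → deg G (vertex v) ≡ sum (applyUpTo (nbr v) (suc (2 * k)))
  degree-as-sum v = begin
    sum (map f (allFin n))
      ≡⟨ cong sum (map-tabulate id f) ⟩
    sum (tabulate f)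
      ≡⟨ cong sum (tabulate-cong {n = n} (λ j → cong f (sym (vertex-toℕ j)))) ⟩
    sum (tabulate {n = n} (nbr v ∘ toℕ))
      ≡⟨ cong sum (tabulate-toℕ n (nbr v)) ⟩
    sum (applyUpTo (nbr v) n) ∎
    where
    open ≡-Reasoning
    n = suc (2 * k)
    f = λ j → if adj G (vertex v) j then 1 else 0

  gap-pointwise : ∀ {v s₁ g₁ s₂ g₂} → s₁ + g₁ ≤ s₂ → s₂ + g₂ ≤ v →
                  Avoids v s₁ g₁ → Avoids v s₂ g₂ →
                  ∀ i → nbr v i + (indicator s₁ g₁ i + indicator s₂ g₂ i + indicator v 1 i) ≤ 1
  gap-pointwise {v} {s₁} {g₁} {s₂} {g₂} sep₁ sep₂ avoid₁ avoid₂ i with indicator-view s₁ g₁ i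
  ... | inj₂ (in₁ , s₁≤i , i<e₁)
    rewrite nbr-zero (avoid₁ i s₁≤i i<e₁) | in₁ | indicator-below {s₂} {g₂} (<-≤-trans i<e₁ sep₁)
          | indicator-below {v} {1} (<-≤-trans i<e₁ (≤-trans sep₁ (≤-trans (m≤m+n s₂ g₂) sep₂)))
          = ≤-refl
  ... | inj₁ out₁ with indicator-view s₂ g₂ i
  ...   | inj₂ (in₂ , s₂≤i , i<e₂)
    rewrite nbr-zero (avoid₂ i s₂≤i i<e₂) | out₁ | in₂ | indicator-below {v} {1} (<-≤-trans i<e₂ sep₂)
          = ≤-refl
  ...   | inj₁ out₂ with indicator-view v 1 i
  ...     | inj₂ (in₃ , v≤i , i<v+1)
    rewrite out₁ | out₂ | in₃ | nbr-zero (λ v~i → ~-irrefl v (subst (v ~_) (m≤n<m+1⇒n≡m v≤i i<v+1) v~i))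
          = ≤-refl
  ...     | inj₁ out₃ rewrite out₁ | out₂ | out₃ | +-identityʳ (nbr v i) = nbr-≤1 v i

  gap-bound : ∀ {v s₁ g₁ s₂ g₂} → s₁ + g₁ ≤ s₂ → s₂ + g₂ ≤ v → v ≤ b →
              Avoids v s₁ g₁ → Avoids v s₂ g₂ →
              deg G (vertex v) + (g₁ + g₂ + 1) ≤ suc b
  gap-bound {v} {s₁} {g₁} {s₂} {g₂} sep₁ sep₂ v≤b avoid₁ avoid₂ = begin
    deg G (vertex v) + (g₁ + g₂ + 1)
      ≡⟨ cong₂ _+_ (degree-as-sum v) (sym gaps) ⟩
    sum (applyUpTo (nbr v) n) + sum (applyUpTo forbidden n)
      ≡⟨ sum-applyUpTo-+ n (nbr v) forbidden ⟨
    sum (applyUpTo (λ i → nbr v i + forbidden i) n)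
      ≤⟨ sum-applyUpTo-≤ n _ (gap-pointwise sep₁ sep₂ avoid₁ avoid₂) ⟩
    n
      ≡⟨ cong suc 2k≡1+a ⟩
    suc b ∎
    where
    open ≤-Reasoning
    n = suc (2 * k)
    forbidden = λ i → indicator s₁ g₁ i + indicator s₂ g₂ i + indicator v 1 i
    v<n : v < n
    v<n = s≤s (≤-trans v≤b (≤-reflexive (sym 2k≡1+a)))
    e₂≤n : s₂ + g₂ ≤ n
    e₂≤n = ≤-trans sep₂ (<⇒≤ v<n)
    e₁≤n = ≤-trans sep₁ (≤-trans (m≤m+n s₂ g₂) e₂≤n)
    gaps : sum (applyUpTo forbidden n) ≡ g₁ + g₂ + 1
    gaps = trans (sum-applyUpTo-+ n (λ i → indicator s₁ g₁ i + indicator s₂ g₂ i) (indicator v 1))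
             (cong₂ _+_ (trans (sum-applyUpTo-+ n (indicator s₁ g₁) (indicator s₂ g₂))
                               (cong₂ _+_ (sum-indicator n s₁ g₁ e₁≤n) (sum-indicator n s₂ g₂ e₂≤n)))
                        (sum-indicator n v 1 (subst (_≤ n) (+-comm 1 v) v<n)))

  module WithDegree (d : ℕ) (d≤deg-a : d ≤ deg G (vertex a)) (d≤deg-b : d ≤ deg G (vertex b)) where

    degree-gaps : ∀ {v s₁ g₁ s₂ g₂} → d ≤ deg G (vertex v) → v ≤ b →
                  s₁ + g₁ ≤ s₂ → s₂ + g₂ ≤ v → Avoids v s₁ g₁ → Avoids v s₂ g₂ →
                  d + (g₁ + g₂ + 1) ≤ suc b
    degree-gaps d≤deg v≤b sep₁ sep₂ avoid₁ avoid₂ =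
      ≤-trans (+-monoˡ-≤ _ d≤deg) (gap-bound sep₁ sep₂ v≤b avoid₁ avoid₂)

    degree-gap : ∀ {v s g} → d ≤ deg G (vertex v) → v ≤ b → s + g ≤ v → Avoids v s g →
                 d + (g + 1) ≤ suc b
    degree-gap {v} {s} {g} d≤deg v≤b s+g≤v avoid =
      subst (λ t → d + (t + 1) ≤ suc b) (+-identityʳ g)
        (degree-gaps d≤deg v≤b s+g≤v (≤-reflexive (+-identityʳ v)) avoid (none-empty v))

    window-from-gaps : ∀ {P s u g} → s ≤ 10 → d + (g + 1) ≤ suc b → u + g ≡ suc b →
                       Flexible s P u → Window d P
    window-from-gaps {u = u} {g} s≤10 bound covers = window d s≤10
      (+-cancelʳ-≤ g (suc d) u (≤-trans (≤-reflexive shuffle) (≤-trans bound (≤-reflexive (sym covers)))))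
      where
      shuffle : suc d + g ≡ d + (g + 1)
      shuffle = sym (trans (cong (d +_) (+-comm g 1)) (+-suc d g))

    -- A segment [s + before, s + before + width] of [s, s + g) whose ends are joined to a and b,
    -- such that all neighbours of a, or all of b, in [s, s + g) lie in the segment.
    record Bridge (s g : ℕ) : Set where
      field
        before width after : ℕ
        widths : before + width + suc after ≡ g
        ends   : (b ~ (s + before) × (s + before + width) ~ a) ⊎
                 (b ~ (s + before + width) × (s + before) ~ a)
        bound  : d + (before + after + 1) ≤ suc b

    -- b, lowest neighbour of b ⋯ highest neighbour of a, a; the neighbours of a lie in between.
    rising-bridge : ∀ {s g} → s + g ≤ a → (B : Span (b ~_) s g) (A : Span (a ~_) s g) →
                    Span.lowest B ≤ Span.lowest A → Bridge s g
    rising-bridge {s} end≤a B A fb≤fa = record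
      { before = B.lowest ; width = w ; after = A.after
      ; widths = trans (cong (_+ suc A.after) fb+w≡la) A.highest+after
      ; ends   = inj₁ (B.at-lowest , subst (_~ a) (sym (+-offset s fb+w≡la)) (~-sym A.at-highest))
      ; bound  = degree-gaps d≤deg-a a≤b (m≤n⇒m≤1+n (+-monoʳ-≤ s fb≤la))
                   (≤-trans (≤-reflexive A.end) end≤a)
                   (none-sub ≤-refl (+-monoʳ-≤ s fb≤fa) A.none-below) A.none-above }
      where
      module A = Span A
      module B = Span B
      fb≤la = ≤-trans fb≤fa A.lowest≤highest
      w = proj₁ (m≤n⇒∃[o]m+o≡n fb≤la)
      fb+w≡la = proj₂ (m≤n⇒∃[o]m+o≡n fb≤la)

    -- b, highest neighbour of b ⋯ lowest neighbour of a, a; the neighbours of whichever of a, b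
    -- has the lower highest neighbour lie in between.
    falling-bridge : ∀ {s g} → s + g ≤ a → (B : Span (b ~_) s g) (A : Span (a ~_) s g) →
                     Span.lowest A < Span.lowest B → Bridge s g
    falling-bridge {s} end≤a B A fa<fb = record
      { before = A.lowest ; width = w ; after = B.after
      ; widths = trans (cong (_+ suc B.after) fa+w≡lb) B.highest+after
      ; ends   = inj₂ (subst (b ~_) (sym (+-offset s fa+w≡lb)) B.at-highest , ~-sym A.at-lowest)
      ; bound  = bound }
      where
      module A = Span A
      module B = Span B
      fa≤lb = ≤-trans (<⇒≤ fa<fb) B.lowest≤highest
      w = proj₁ (m≤n⇒∃[o]m+o≡n fa≤lb)
      fa+w≡lb = proj₂ (m≤n⇒∃[o]m+o≡n fa≤lb)
      sep = m≤n⇒m≤1+n (+-monoʳ-≤ s fa≤lb)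
      bound : d + (A.lowest + B.after + 1) ≤ suc b
      bound with A.highest ≤? B.highest
      ... | yes la≤lb = degree-gaps d≤deg-a a≤b sep (≤-trans (≤-reflexive B.end) end≤a) A.none-below
                          (none-sub (s≤s (+-monoʳ-≤ s la≤lb)) (≤-reflexive (trans B.end (sym A.end)))
                                    A.none-above)
      ... | no _      = degree-gaps d≤deg-b ≤-refl sep (≤-trans (≤-reflexive B.end) (m≤n⇒m≤1+n end≤a))
                          (none-sub ≤-refl (+-monoʳ-≤ s (<⇒≤ fa<fb)) B.none-below) B.none-above

    bridge : ∀ {s g} → s + g ≤ a → Span (b ~_) s g → Span (a ~_) s g → Bridge s g
    bridge end≤a B A with Span.lowest B ≤? Span.lowest A
    ... | yes fb≤fa = rising-bridge end≤a B A fb≤fa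
    ... | no fb≰fa  = falling-bridge end≤a B A (≰⇒> fb≰fa)

    bridge-or-gap : ∀ s g → s + g ≤ a → Bridge s g ⊎ d + (g + 1) ≤ suc b
    bridge-or-gap s g end≤a with span-in (b ~?_) s g | span-in (a ~?_) s g
    ... | inj₁ none | _         = inj₂ (degree-gap d≤deg-b ≤-refl (m≤n⇒m≤1+n end≤a) none)
    ... | inj₂ _    | inj₁ none = inj₂ (degree-gap d≤deg-a a≤b end≤a none)
    ... | inj₂ B    | inj₂ A    = inj₁ (bridge end≤a B A)

    round-bridge : ∀ {x g w₄} → Bridge (suc x) g → suc x + g + w₄ ≡ a →
                   Window d (Path 0 b x (suc x + g))
    round-bridge {x} {w₄ = w₄}
      record { before = β ; width = w ; after = α ; widths = refl ; ends = ends ; bound = bound } y+w₄≡a =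
      window-from-gaps ≤-refl bound covers (through ends)
      where
      lo = suc x + β
      y = suc x + (β + w + suc α)
      lo+w<y : lo + w < y
      lo+w<y = ≤-trans (m≤m+n (suc (lo + w)) α)
                       (≤-reflexive (trans (sym (+-suc (lo + w) α)) (reshape x β w α)))
        where reshape : ∀ x β w α → suc x + β + w + suc α ≡ suc x + (β + w + suc α)
              reshape = solve-∀
      hi≤b : lo + w ≤ b
      hi≤b = ≤-trans (<⇒≤ lo+w<y) (≤-trans (m≤m+n y w₄) (m≤n⇒m≤1+n (≤-reflexive y+w₄≡a)))
      through : (b ~ lo × (lo + w) ~ a) ⊎ (b ~ (lo + w) × lo ~ a) →
                Flexible 10 (Path 0 b x y) (suc x + (1 + (suc w + suc w₄)))
      x<lo = m≤m+n (suc x) β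
      through (inj₁ (b~lo , hi~a)) = round-b-middle x<lo lo+w<y y+w₄≡a b~lo hi~a (run w refl hi≤b)
      through (inj₂ (b~hi , lo~a)) = round-b-middle x<lo lo+w<y y+w₄≡a b~hi lo~a (descent w refl hi≤b)
      covers : suc x + (1 + (suc w + suc w₄)) + (β + α) ≡ suc b
      covers = trans (count x β w α w₄) (cong (suc ∘ suc) y+w₄≡a)
        where
        count : ∀ x β w α w₄ →
                suc x + (1 + (suc w + suc w₄)) + (β + α) ≡ suc (suc (suc x + (β + w + suc α) + w₄))
        count = solve-∀

    below-a : ∀ {x y} → x < y → y ≤ a → Window d (Path 0 b x y)
    below-a {x} x<y y≤a with m≤n⇒∃[o]m+o≡n x<y | m≤n⇒∃[o]m+o≡n y≤a
    ... | g , refl | w₄ , y+w₄≡a with bridge-or-gap (suc x) g y≤a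
    ...   | inj₁ B     = round-bridge B y+w₄≡a
    ...   | inj₂ bound = window-from-gaps (m≤m+n 7 3) bound covers (round-b x<y y+w₄≡a)
      where
      covers : suc x + (1 + suc w₄) + g ≡ suc b
      covers = trans (count x g w₄) (cong (suc ∘ suc) y+w₄≡a)
        where count : ∀ x g w₄ → suc x + (1 + suc w₄) + g ≡ suc (suc (suc x + g + w₄))
              count = solve-∀

    to-b : ∀ {x} → x ≤ a → Window d (Path 0 b x b)
    to-b {x} x≤a with m≤n⇒∃[o]m+o≡n x≤a | last-in (a ~?_) 0 x
    ... | w , x+w≡a | inj₁ none =
      window-from-gaps (m≤m+n 4 6) (degree-gap d≤deg-a a≤b x≤a none) covers (up-to-b x+w≡a)
      where
      covers : suc w + 1 + x ≡ suc b
      covers = trans (count x w) (cong (suc ∘ suc) x+w≡a)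
        where count : ∀ x w → suc w + 1 + x ≡ suc (suc (x + w))
              count = solve-∀
    ... | w , x+w≡a | inj₂ (r , r′ , refl , a~r , none) =
      window-from-gaps (m≤m+n 7 3) (degree-gap d≤deg-a a≤b gap≤a none) covers
                       (up-back-to-b x+w≡a r<x a~r)
      where
      r<x : r < r + suc r′
      r<x = m<m+n r z<s
      gap≤a : suc r + r′ ≤ a
      gap≤a = ≤-trans (≤-reflexive (sym (+-suc r r′))) x≤a
      covers : suc w + suc r + 1 + r′ ≡ suc b
      covers = trans (count r r′ w) (cong (suc ∘ suc) x+w≡a)
        where count : ∀ r r′ w → suc w + suc r + 1 + r′ ≡ suc (suc (r + suc r′ + w))
              count = solve-∀

    between : ∀ {x y} → x < y → y ≤ b → Window d (Path 0 b x y)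
    between x<y y≤b with m≤n⇒m<n∨m≡n y≤b
    ... | inj₁ y<b  = below-a x<y (s≤s⁻¹ y<b)
    ... | inj₂ refl = to-b (s≤s⁻¹ x<y)

    inR : ∀ {x y m} → Path 0 b x y m → InR G (vertex x) (vertex y) m
    inR {x} {y} p =
      map vertex vs ,
      ( trans (head-map {f = vertex} vs) (cong (Maybe.map vertex) (head-vertices (walk p)))
      , trans (last-map vertex vs) (cong (Maybe.map vertex) (last-vertices (walk p)))
      , Unique.map⁻ (subst Unique (sym toℕ-vertices) (unique p))
      , linked⇒adjChain (Linked.map⁺ (Linked.map adjacent (linked-vertices (walk p)))) ) ,
      trans (length-map vertex vs) (order p)
      where
      vs = vertices (walk p)
      toℕ-vertices : map toℕ (map vertex vs) ≡ vs
      toℕ-vertices = trans (sym (map-∘ vs))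
                           (map-id-local (All.map (λ (_ , i≤b) → toℕ-vertex i≤b) (inside p)))

    toℕ≤b : ∀ (j : Fin (suc (2 * k))) → toℕ j ≤ b
    toℕ≤b j = subst (toℕ j ≤_) 2k≡1+a (toℕ≤pred[n] j)

    inR-from-toℕ : ∀ {x y m} → InR G (vertex (toℕ x)) (vertex (toℕ y)) m → InR G x y m
    inR-from-toℕ {x} {y} {m} = subst₂ (λ u v → InR G u v m) (vertex-toℕ x) (vertex-toℕ y)

    saw-window : ∀ (x y : Fin (suc (2 * k))) → x ≢ y → Window d (InR G x y)
    saw-window x y x≢y with <-cmp (toℕ x) (toℕ y)
    ... | tri< x<y _ _ = window-map (inR-from-toℕ ∘ inR) (between x<y (toℕ≤b y))
    ... | tri≈ _ x≡y _ = contradiction (toℕ-injective x≡y) x≢y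
    ... | tri> _ _ y<x = window-map (inR-from-toℕ ∘ inR ∘ reversePath) (between y<x (toℕ≤b x))

lemma10 : (k : ℕ) → 1 ≤ k → (G : Graph (suc (2 * k))) → IsSaw k G →
          k ≤ sawDeg k G → (x y : Fin (suc (2 * k))) → ¬ (x ≡ y) →
          Σ ℕ (λ l → sawDeg k G < l ×
            (∀ m → l + 5 ≤ m + ⌈ sawDeg k G /2⌉ → m ≤ l → InR G x y m))
lemma10 k@(suc j) _ G saw _ =
  WithDegree.saw-window (sawDeg k G)
    (≤-trans (m⊓n≤m _ _) (≤-reflexive (cong (deg G) prev≡)))
    (≤-trans (m⊓n≤n _ _) (≤-reflexive (cong (deg G) last≡)))
  where
  a = 2 * k ∸ 1
  open Saw k a refl G saw
  prev≡ : vPrev k ≡ vertex a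
  prev≡ = toℕ-injective (trans (trans (toℕ-inject₁ (fromℕ a)) (toℕ-fromℕ a)) (sym (toℕ-vertex a≤b)))
  last≡ : vLast k ≡ vertex b
  last≡ = toℕ-injective (trans (toℕ-fromℕ b) (sym (toℕ-vertex ≤-refl)))
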